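{- Let $k$ be an odd positive integer and let $G$ be a $k$-tree. Then $\mathrm{T}(G)=\frac{k+1}{2}$.
   Context: All graphs are finite, simple and undirected. A $k$-tree is a graph obtained by starting from the complete graph $K_{k+1}$ and repeatedly adding a new vertex adjacent to exactly the vertices of some existing clique on $k$ vertices. The tree cover number $\mathrm{T}(G)$ is the minimum number of vertex-disjoint induced trees of $G$ covering $V(G)$. -}

module Defs where

open import Data.Nat using (ℕ; zero; suc; _≤_; _≥_)
open import Data.Fin using (Fin; zero; suc; inject₁; fromℕ)
open import Data.Fin.Subset using (Subset; _∈_; ∣_∣)
open import Data.Bool using (Bool; true; false)
open import Data.Product using (Σ; _×_; _,_; ∃)
open import Relation.Binary.PropositionalEquality using (_≡_; _≢_)
open import Function.Bundles using (_↔_; Inverse)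
open import Function.Definitions using (Injective)

record Graph (n : ℕ) : Set where
  field
    adj    : Fin n → Fin n → Bool
    sym    : ∀ i j → adj i j ≡ adj j i
    irrefl : ∀ i → adj i i ≡ false
open Graph public

Adjacent : ∀ {n} → Graph n → Fin n → Fin n → Set
Adjacent G i j = adj G i j ≡ true

IsClique : ∀ {n} → Graph n → Subset n → Set
IsClique G S = ∀ i j → i ∈ S → j ∈ S → i ≢ j → Adjacent G i j

IsComplete : ∀ {n} → Graph n → Set
IsComplete G = ∀ i j → i ≢ j → Adjacent G i j

_≅_ : ∀ {n} → Graph n → Graph n → Set
_≅_ {n} G H = Σ (Fin n ↔ Fin n) λ π →
  ∀ i j → adj G i j ≡ adj H (Inverse.to π i) (Inverse.to π j)

-- Labelled construction of k-trees: start from K_{k+1} on Fin (suc k);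
-- repeatedly add a new vertex (the last one, fromℕ n) adjacent to exactly
-- the vertices of an existing clique on k vertices; old vertices keep
-- their adjacency (via inject₁).
data BuiltKTree (k : ℕ) : (n : ℕ) → Graph n → Set where
  base : (G : Graph (suc k)) → IsComplete G → BuiltKTree k (suc k) G
  step : ∀ {n} {G : Graph n} → BuiltKTree k n G →
         (C : Subset n) → ∣ C ∣ ≡ k → IsClique G C →
         (G' : Graph (suc n)) →
         (∀ i j → adj G' (inject₁ i) (inject₁ j) ≡ adj G i j) →
         (∀ i → (Adjacent G' (fromℕ n) (inject₁ i) → i ∈ C)
              × (i ∈ C → Adjacent G' (fromℕ n) (inject₁ i))) →
         BuiltKTree k (suc n) G'

IsKTree : ∀ {n} → ℕ → Graph n → Set
IsKTree {n} k G = Σ (Graph n) λ H → BuiltKTree k n H × (G ≅ H)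

data WalkIn {n} (G : Graph n) (S : Fin n → Set) : Fin n → Fin n → Set where
  here  : ∀ {u} → S u → WalkIn G S u u
  there : ∀ {u w v} → S u → Adjacent G u w → WalkIn G S w v → WalkIn G S u v

-- A cycle of G inside S: distinct vertices f 0, …, f l (l ≥ 2, i.e. at
-- least 3 vertices), consecutive ones adjacent, and f l adjacent to f 0.
record CycleIn {n} (G : Graph n) (S : Fin n → Set) : Set where
  field
    len      : ℕ
    len≥2    : len ≥ 2
    f        : Fin (suc len) → Fin n
    f-inj    : Injective _≡_ _≡_ f
    f-in     : ∀ j → S (f j)
    f-consec : ∀ (j : Fin len) → Adjacent G (f (inject₁ j)) (f (suc j))
    f-close  : Adjacent G (f (fromℕ len)) (f zero)

InducesTree : ∀ {n} → Graph n → (Fin n → Set) → Set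
InducesTree G S =
  (∃ λ v → S v)
  × (∀ u v → S u → S v → WalkIn G S u v)
  × (CycleIn G S → Data.Empty.⊥)
  where import Data.Empty

-- A tree cover of G with m trees: a partition c : Fin n → Fin m of the
-- vertices into m classes, each inducing a tree (so in particular nonempty).
TreeCover : ∀ {n} → Graph n → ℕ → Set
TreeCover {n} G m = Σ (Fin n → Fin m) λ c →
  ∀ (t : Fin m) → InducesTree G (λ v → c v ≡ t)

TreeCoverNumberIs : ∀ {n} → Graph n → ℕ → Set
TreeCoverNumberIs G m = TreeCover G m × (∀ m' → TreeCover G m' → m ≤ m')

module Submission where

-- Lower bound.  A k-tree contains a clique on k + 1 = 2(h + 1) vertices.  A
-- class of a tree cover meets a clique in at most two vertices (three would
-- span a triangle), so any tree cover with m trees satisfies 2(h + 1) ≤ 2m.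
--
-- Upper bound, by induction on the construction of the k-tree.  The initial
-- K_{2(h+1)} is covered by h + 1 edges.  When a new vertex is attached to a
-- k-clique C, every class of the current cover meets C in at most two
-- vertices; as |C| = 2h + 1 is odd, some vertex w of C is the only vertex of
-- C in its class.  Putting the new vertex into the class of w attaches it as
-- a leaf to that tree, and all classes still induce trees.

open import Defs
open import Data.Nat using (ℕ; suc; _+_)
open import Data.Nat.DivMod using (_%_; _/_)
open import Relation.Binary.PropositionalEquality using (_≡_)

open import Data.Nat using (zero; _≤_; z≤n; s≤s; _*_)
import Data.Nat.Properties as ℕ
open import Data.Nat.DivMod using (m*n/n≡m)
import Data.Fin as Fin
open import Data.Fin using (Fin; zero; suc; inject₁; fromℕ; toℕ; lower₁; punchIn; punchOut)
open import Data.Fin.Properties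
  using (any?; 0≢1+n; suc-injective; toℕ-injective; toℕ-fromℕ; toℕ-inject₁; toℕ-lower₁;
         inject₁-lower₁; punchOut-cong; punchOut-injective; punchIn-punchOut; punchInᵢ≢i;
         punchIn-injective)
  renaming (_≟_ to _≟ᶠ_)
open import Data.Fin.Subset using (Subset; _∈_; ∣_∣)
open import Data.Vec.Base using (_∷_; here; there)
open import Data.Bool using (true; false)
open import Data.Product using (Σ; _×_; _,_; ∃; ∃₂; proj₁; proj₂)
open import Data.Sum using (_⊎_; inj₁; inj₂)
import Data.Sum as Sum
open import Data.Empty using (⊥; ⊥-elim)
open import Relation.Nullary using (Dec; yes; no)
open import Relation.Binary.PropositionalEquality
  using (_≢_; refl; trans; cong; subst; subst₂; module ≡-Reasoning)
  renaming (sym to ≡-sym)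
open import Function using (_∘_)
open import Function.Bundles using (Inverse)
open import Function.Definitions using (Injective)

Adjacent-sym : ∀ {n} (G : Graph n) {x y} → Adjacent G x y → Adjacent G y x
Adjacent-sym G {x} {y} x~y = trans (Graph.sym G y x) x~y

Adjacent⇒≢ : ∀ {n} (G : Graph n) {x y} → Adjacent G x y → x ≢ y
Adjacent⇒≢ G {x} x~x refl with trans (≡-sym x~x) (irrefl G x)
... | ()

Class : ∀ {n m} → (Fin n → Fin m) → Fin m → Fin n → Set
Class c s v = c v ≡ s

IsTreeCover : ∀ {n m} → Graph n → (Fin n → Fin m) → Set
IsTreeCover G c = ∀ s → InducesTree G (Class c s)

walk-image : ∀ {n n′} {G : Graph n} {G′ : Graph n′} {S : Fin n → Set} {S′ : Fin n′ → Set}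
  (φ : Fin n → Fin n′) → (∀ {x} → S x → S′ (φ x)) →
  (∀ {x y} → Adjacent G x y → Adjacent G′ (φ x) (φ y)) →
  ∀ {u v} → WalkIn G S u v → WalkIn G′ S′ (φ u) (φ v)
walk-image φ inS adjacent (here su)          = here (inS su)
walk-image φ inS adjacent (there su u~w walk) = there (inS su) (adjacent u~w) (walk-image φ inS adjacent walk)

walk-snoc : ∀ {n} {G : Graph n} {S : Fin n → Set} {u v x} →
  WalkIn G S u v → Adjacent G v x → S x → WalkIn G S u x
walk-snoc (here su)          v~x sx = there su v~x (here sx)
walk-snoc (there su u~w walk) v~x sx = there su u~w (walk-snoc walk v~x sx)

cycle-image : ∀ {n n′} {G : Graph n} {G′ : Graph n′} {S : Fin n → Set} {S′ : Fin n′ → Set}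
  (Cy : CycleIn G S) → let open CycleIn Cy in
  (g : Fin (suc len) → Fin n′) → (∀ {a b} → g a ≡ g b → f a ≡ f b) → (∀ j → S′ (g j)) →
  (∀ a b → Adjacent G (f a) (f b) → Adjacent G′ (g a) (g b)) → CycleIn G′ S′
cycle-image Cy g reflects inS′ adjacent = record
  { len = len ; len≥2 = len≥2 ; f = g ; f-inj = f-inj ∘ reflects ; f-in = inS′
  ; f-consec = λ j → adjacent _ _ (f-consec j) ; f-close = adjacent _ _ f-close }
  where open CycleIn Cy

triangle : ∀ {n} {G : Graph n} {S : Fin n → Set} {x y z} →
  x ≢ y → x ≢ z → y ≢ z → S x → S y → S z →
  Adjacent G x y → Adjacent G y z → Adjacent G z x → CycleIn G S
triangle {n} {G} {S} {x} {y} {z} x≢y x≢z y≢z sx sy sz x~y y~z z~x = record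
  { len = 2 ; len≥2 = s≤s (s≤s z≤n) ; f = corner ; f-inj = injective ; f-in = inS
  ; f-consec = edge ; f-close = z~x }
  where
  corner : Fin 3 → Fin n
  corner zero             = x
  corner (suc zero)       = y
  corner (suc (suc zero)) = z
  inS : ∀ j → S (corner j)
  inS zero             = sx
  inS (suc zero)       = sy
  inS (suc (suc zero)) = sz
  edge : ∀ (j : Fin 2) → Adjacent G (corner (inject₁ j)) (corner (suc j))
  edge zero       = x~y
  edge (suc zero) = y~z
  injective : Injective _≡_ _≡_ corner
  injective {zero}           {zero}           _ = refl
  injective {zero}           {suc zero}       e = ⊥-elim (x≢y e)
  injective {zero}           {suc (suc zero)} e = ⊥-elim (x≢z e)
  injective {suc zero}       {zero}           e = ⊥-elim (x≢y (≡-sym e))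
  injective {suc zero}       {suc zero}       _ = refl
  injective {suc zero}       {suc (suc zero)} e = ⊥-elim (y≢z e)
  injective {suc (suc zero)} {zero}           e = ⊥-elim (x≢z (≡-sym e))
  injective {suc (suc zero)} {suc zero}       e = ⊥-elim (y≢z (≡-sym e))
  injective {suc (suc zero)} {suc (suc zero)} _ = refl

AtMostTwo : ∀ {n} → (Fin n → Set) → Set
AtMostTwo S = ∀ {x y z} → S x → S y → S z → x ≡ y ⊎ x ≡ z ⊎ y ≡ z

within-two : ∀ {n} {S : Fin n → Set} {p q : Fin n} → (∀ {x} → S x → x ≡ p ⊎ x ≡ q) → AtMostTwo S
within-two within sx sy sz with within sx | within sy | within sz
... | inj₁ refl | inj₁ refl | _         = inj₁ refl
... | inj₁ refl | inj₂ refl | inj₁ refl = inj₂ (inj₁ refl)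
... | inj₁ refl | inj₂ refl | inj₂ refl = inj₂ (inj₂ refl)
... | inj₂ refl | inj₂ refl | _         = inj₁ refl
... | inj₂ refl | inj₁ refl | inj₁ refl = inj₂ (inj₂ refl)
... | inj₂ refl | inj₁ refl | inj₂ refl = inj₂ (inj₁ refl)

-- A cycle has at least three vertices, so a set of at most two vertices
-- contains no cycle.
small-acyclic : ∀ {n} {G : Graph n} {S : Fin n → Set} → AtMostTwo S → CycleIn G S → ⊥
small-acyclic two record { len = zero ; len≥2 = () }
small-acyclic two record { len = suc zero ; len≥2 = s≤s () }
small-acyclic two record { len = suc (suc L) ; f-inj = injective ; f-in = inS }
  with two (inS zero) (inS (suc zero)) (inS (suc (suc zero)))
... | inj₁ e        = 0≢1+n (injective e)
... | inj₂ (inj₁ e) = 0≢1+n (injective e)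
... | inj₂ (inj₂ e) = 0≢1+n (suc-injective (injective e))

data LastView {n} : Fin (suc n) → Set where
  last : LastView (fromℕ n)
  old  : (i : Fin n) → LastView (inject₁ i)

view : ∀ {n} (x : Fin (suc n)) → LastView x
view {zero}  zero    = last
view {suc n} zero    = old zero
view {suc n} (suc x) with view x
... | last  = last
... | old i = old (suc i)

lower : ∀ {n} (x : Fin (suc n)) → x ≢ fromℕ n → Fin n
lower {n} x x≢last =
  lower₁ x (λ n≡x → x≢last (toℕ-injective (trans (≡-sym n≡x) (≡-sym (toℕ-fromℕ n)))))

inject₁-lower : ∀ {n} (x : Fin (suc n)) (x≢last : x ≢ fromℕ n) → inject₁ (lower x x≢last) ≡ x
inject₁-lower x _ = inject₁-lower₁ x _

toℕ-lower : ∀ {n} (x : Fin (suc n)) (x≢last : x ≢ fromℕ n) → toℕ (lower x x≢last) ≡ toℕ x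
toℕ-lower x _ = toℕ-lower₁ x _

extendLast : ∀ {n} {A : Set} → (Fin n → A) → A → Fin (suc n) → A
extendLast {zero}  c a _       = a
extendLast {suc n} c a zero    = c zero
extendLast {suc n} c a (suc x) = extendLast (c ∘ suc) a x

extendLast-old : ∀ {n} {A : Set} (c : Fin n → A) a i → extendLast c a (inject₁ i) ≡ c i
extendLast-old {suc n} c a zero    = refl
extendLast-old {suc n} c a (suc i) = extendLast-old (c ∘ suc) a i

extendLast-last : ∀ {n} {A : Set} (c : Fin n → A) a → extendLast c a (fromℕ n) ≡ a
extendLast-last {zero}  c a = refl
extendLast-last {suc n} c a = extendLast-last (c ∘ suc) a

-- Every vertex on a cycle has two different neighbours on the cycle:
-- position j is adjacent to the positions before and after it (cyclically),
-- and these differ because the cycle has at least three positions.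
cycle-neighbours : ∀ {n} {G : Graph n} {S : Fin n → Set} (Cy : CycleIn G S) →
  let open CycleIn Cy in
  ∀ j → ∃₂ λ a b → a ≢ b × Adjacent G (f j) (f a) × Adjacent G (f j) (f b)
cycle-neighbours record { len = zero ; len≥2 = () }
cycle-neighbours record { len = suc zero ; len≥2 = s≤s () }
cycle-neighbours {G = G} record { len = suc (suc L) ; f = f ; f-consec = edge ; f-close = close } = neighbours
  where
  final : Fin (suc (suc (suc L)))
  final = fromℕ (suc (suc L))

  before-final≢0 : ∀ j → suc j ≡ final → inject₁ j ≢ zero
  before-final≢0 zero    ()
  before-final≢0 (suc j) _ ()

  -- toℕ (inject₁ j) = toℕ j while toℕ (suc (lower (suc j) _)) = toℕ j + 2
  before≢after : ∀ j (j+1≢final : suc j ≢ final) → inject₁ j ≢ suc (lower (suc j) j+1≢final)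
  before≢after j j+1≢final e = ℕ.m≢1+n+m (toℕ j) {1} (begin
    toℕ j                              ≡⟨ ≡-sym (toℕ-inject₁ j) ⟩
    toℕ (inject₁ j)                    ≡⟨ cong toℕ e ⟩
    suc (toℕ (lower (suc j) j+1≢final)) ≡⟨ cong suc (toℕ-lower (suc j) j+1≢final) ⟩
    suc (suc (toℕ j))                  ∎)
    where open ≡-Reasoning

  neighbours : ∀ j → ∃₂ λ a b → a ≢ b × Adjacent G (f j) (f a) × Adjacent G (f j) (f b)
  neighbours zero = suc zero , final , (λ ()) , edge zero , Adjacent-sym G close
  neighbours (suc j) with suc j ≟ᶠ final
  ... | yes j+1≡final = inject₁ j , zero , before-final≢0 j j+1≡final , Adjacent-sym G (edge j) ,
          subst (λ x → Adjacent G (f x) (f zero)) (≡-sym j+1≡final) close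
  ... | no j+1≢final = inject₁ j , suc after , before≢after j j+1≢final , Adjacent-sym G (edge j) ,
          subst (λ x → Adjacent G (f x) (f (suc after))) (inject₁-lower (suc j) j+1≢final) (edge after)
    where
    after = lower (suc j) j+1≢final

-- double h = 2h, by a recursion matching the shape of odd numbers 2h + 1.
double : ℕ → ℕ
double zero    = zero
double (suc h) = suc (suc (double h))

AtMostTwoToOne : ∀ {a b} → (Fin a → Fin b) → Set
AtMostTwoToOne g = ∀ x y z → x ≢ y → x ≢ z → y ≢ z → g x ≡ g y → g x ≡ g z → ⊥

Isolated : ∀ {a b} → (Fin a → Fin b) → Fin a → Set
Isolated g x = ∀ y → g y ≡ g x → y ≡ x

isolated-or-paired : ∀ {a b} (g : Fin (suc a) → Fin b) → Isolated g zero ⊎ ∃ λ p → g (suc p) ≡ g zero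
isolated-or-paired g with any? (λ y → g (suc y) ≟ᶠ g zero)
... | yes paired  = inj₂ paired
... | no unpaired = inj₁ λ { zero _ → refl ; (suc y) gy≡g0 → ⊥-elim (unpaired (y , gy≡g0)) }

module Restriction {a a′ b} (g : Fin a → Fin (suc b)) (v : Fin (suc b))
  (ι : Fin a′ → Fin a) (ι-injective : Injective _≡_ _≡_ ι) (avoids : ∀ j → v ≢ g (ι j)) where

  restriction : Fin a′ → Fin b
  restriction j = punchOut (avoids j)

  restriction-atMostTwoToOne : AtMostTwoToOne g → AtMostTwoToOne restriction
  restriction-atMostTwoToOne two x y z x≢y x≢z y≢z e₁ e₂ =
    two (ι x) (ι y) (ι z) (x≢y ∘ ι-injective) (x≢z ∘ ι-injective) (y≢z ∘ ι-injective)
        (punchOut-injective (avoids x) (avoids y) e₁) (punchOut-injective (avoids x) (avoids z) e₂)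

  restriction-isolated : (∀ z → g z ≡ v ⊎ ∃ λ z′ → ι z′ ≡ z) →
    ∀ {x} → Isolated restriction x → Isolated g (ι x)
  restriction-isolated covers {x} isolated z gz≡gx with covers z
  ... | inj₁ gz≡v        = ⊥-elim (avoids x (trans (≡-sym gz≡v) gz≡gx))
  ... | inj₂ (z′ , refl) = cong ι (isolated z′ (punchOut-cong v gz≡gx))

module DropIsolated {a b} (g : Fin (suc a) → Fin (suc b)) (isolated : Isolated g zero) where

  avoids : ∀ j → g zero ≢ g (suc j)
  avoids j g0≡gj with isolated (suc j) (≡-sym g0≡gj)
  ... | ()

  open Restriction g (g zero) suc suc-injective avoids public

module DropPair {a b} (g : Fin (suc (suc a)) → Fin (suc b)) (two : AtMostTwoToOne g)
  (p : Fin (suc a)) (paired : g (suc p) ≡ g zero) where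

  ι : Fin a → Fin (suc (suc a))
  ι = suc ∘ punchIn p

  ι-injective : Injective _≡_ _≡_ ι
  ι-injective = punchIn-injective p _ _ ∘ suc-injective

  avoids : ∀ j → g zero ≢ g (ι j)
  avoids j = two zero (suc p) (ι j) (λ ()) (λ ()) (punchInᵢ≢i p j ∘ ≡-sym ∘ suc-injective) (≡-sym paired)

  covers : ∀ z → g z ≡ g zero ⊎ ∃ λ z′ → ι z′ ≡ z
  covers zero = inj₁ refl
  covers (suc z) with p ≟ᶠ z
  ... | yes refl = inj₁ paired
  ... | no p≢z   = inj₂ (punchOut p≢z , cong suc (punchIn-punchOut p≢z))

  open Restriction g (g zero) ι ι-injective avoids public

-- Removing 0 together with its partner, if any, costs one value: a ≤ 2b.
atMostTwoToOne-bound : ∀ {a b} (g : Fin a → Fin b) → AtMostTwoToOne g → a ≤ double b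
atMostTwoToOne-bound {zero}        g two = z≤n
atMostTwoToOne-bound {suc a} {zero} g two with g zero
... | ()
atMostTwoToOne-bound {suc zero}    {suc b} g two = s≤s z≤n
atMostTwoToOne-bound {suc (suc a)} {suc b} g two with isolated-or-paired g
... | inj₁ isolated = s≤s (ℕ.m≤n⇒m≤1+n (atMostTwoToOne-bound restriction (restriction-atMostTwoToOne two)))
  where open DropIsolated g isolated
... | inj₂ (p , paired) = s≤s (s≤s (atMostTwoToOne-bound restriction (restriction-atMostTwoToOne two)))
  where open DropPair g two p paired

-- Parity: removing pairs from a set of odd size leaves an isolated point.
odd-isolated : ∀ {a b} h → a ≡ suc (double h) → (g : Fin a → Fin b) → AtMostTwoToOne g → ∃ (Isolated g)
odd-isolated zero refl g _ = zero , λ { zero _ → refl }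
odd-isolated {b = zero} (suc h) refl g _ with g zero
... | ()
odd-isolated {b = suc b} (suc h) refl g two with isolated-or-paired g
... | inj₁ isolated     = zero , isolated
... | inj₂ (p , paired) = ι (proj₁ found) , restriction-isolated covers (proj₂ found)
  where
  open DropPair g two p paired
  found : ∃ (Isolated restriction)
  found = odd-isolated h refl restriction (restriction-atMostTwoToOne two)

elements : ∀ {n} (p : Subset n) → Fin ∣ p ∣ → Fin n
elements (true  ∷ p) zero    = zero
elements (true  ∷ p) (suc a) = suc (elements p a)
elements (false ∷ p) a       = suc (elements p a)

elements-injective : ∀ {n} (p : Subset n) → Injective _≡_ _≡_ (elements p)
elements-injective (true  ∷ p) {zero}  {zero}  _ = refl
elements-injective (true  ∷ p) {suc a} {suc b} e = cong suc (elements-injective p (suc-injective e))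
elements-injective (false ∷ p)                 e = elements-injective p (suc-injective e)

elements-∈ : ∀ {n} (p : Subset n) a → elements p a ∈ p
elements-∈ (true  ∷ p) zero    = here
elements-∈ (true  ∷ p) (suc a) = there (elements-∈ p a)
elements-∈ (false ∷ p) a       = there (elements-∈ p a)

elements-onto : ∀ {n} (p : Subset n) x → x ∈ p → ∃ λ a → elements p a ≡ x
elements-onto (true  ∷ p) zero    _           = zero , refl
elements-onto (true  ∷ p) (suc x) (there x∈p) with elements-onto p x x∈p
... | a , refl = suc a , refl
elements-onto (false ∷ p) (suc x) (there x∈p) with elements-onto p x x∈p
... | a , refl = a , refl

Clique : ∀ {n} → Graph n → ℕ → Set
Clique {n} G a = Σ (Fin a → Fin n) λ e → ∀ x y → x ≢ y → Adjacent G (e x) (e y)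

clique-injective : ∀ {n a} {G : Graph n} (K : Clique G a) → Injective _≡_ _≡_ (proj₁ K)
clique-injective {G = G} (e , adjacent) {x} {y} ex≡ey with x ≟ᶠ y
... | yes x≡y = x≡y
... | no x≢y  = ⊥-elim (Adjacent⇒≢ G (adjacent x y x≢y) ex≡ey)

-- Each class of a tree cover meets a clique in at most two vertices, since
-- three would span a triangle inside the class.
clique-colours : ∀ {n m a} {G : Graph n} (c : Fin n → Fin m) → IsTreeCover G c →
  (K : Clique G a) → AtMostTwoToOne (c ∘ proj₁ K)
clique-colours {G = G} c trees K@(e , adjacent) x y z x≢y x≢z y≢z cx≡cy cx≡cz =
  proj₂ (proj₂ (trees (c (e x))))
    (triangle (x≢y ∘ injective) (x≢z ∘ injective) (y≢z ∘ injective) refl (≡-sym cx≡cy) (≡-sym cx≡cz)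
      (adjacent x y x≢y) (adjacent y z y≢z) (adjacent z x (x≢z ∘ ≡-sym)))
  where
  injective : Injective _≡_ _≡_ e
  injective = clique-injective {G = G} K

clique-bound : ∀ {n a m} {G : Graph n} → Clique G a → TreeCover G m → a ≤ double m
clique-bound K (c , trees) = atMostTwoToOne-bound (c ∘ proj₁ K) (clique-colours c trees K)

-- Base case: the complete graph on 2m vertices is covered by the m edges
-- {first s, second s}, the classes of pairIndex.

pairIndex : ∀ {m} → Fin (double m) → Fin m
pairIndex {suc m} zero          = zero
pairIndex {suc m} (suc zero)    = zero
pairIndex {suc m} (suc (suc x)) = suc (pairIndex x)

first second : ∀ {m} → Fin m → Fin (double m)
first  zero    = zero
first  (suc s) = suc (suc (first s))
second zero    = suc zero
second (suc s) = suc (suc (second s))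

pairIndex-first : ∀ {m} (s : Fin m) → pairIndex (first s) ≡ s
pairIndex-first zero    = refl
pairIndex-first (suc s) = cong suc (pairIndex-first s)

pairIndex-fibre : ∀ {m} (x : Fin (double m)) → x ≡ first (pairIndex x) ⊎ x ≡ second (pairIndex x)
pairIndex-fibre {suc m} zero          = inj₁ refl
pairIndex-fibre {suc m} (suc zero)    = inj₂ refl
pairIndex-fibre {suc m} (suc (suc x)) =
  Sum.map (cong (Fin.suc ∘ Fin.suc)) (cong (Fin.suc ∘ Fin.suc)) (pairIndex-fibre x)

pairIndex-class : ∀ {m} (s : Fin m) {x} → Class pairIndex s x → x ≡ first s ⊎ x ≡ second s
pairIndex-class s {x} refl = pairIndex-fibre x

pairing-cover : ∀ {m} {G : Graph (double m)} → IsComplete G → TreeCover G m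
pairing-cover {G = G} complete = pairIndex , λ s → (first s , pairIndex-first s) , connected s , acyclic s
  where
  connected : ∀ s u v → Class pairIndex s u → Class pairIndex s v → WalkIn G (Class pairIndex s) u v
  connected s u v su sv with u ≟ᶠ v
  ... | yes refl = here su
  ... | no u≢v   = there su (complete u v u≢v) (here sv)
  acyclic : ∀ s → CycleIn G (Class pairIndex s) → ⊥
  acyclic s = small-acyclic (within-two (pairIndex-class s))

-- If c is a tree cover of
-- H and w is the only vertex of its class adjacent to the new vertex (and is
-- adjacent to it), then giving the new vertex the colour of w yields a tree
-- cover of H′: the new vertex hangs as a leaf below w.

Extends : ∀ {n} → Graph (suc n) → Graph n → Set
Extends H′ H = ∀ i j → adj H′ (inject₁ i) (inject₁ j) ≡ adj H i j

module AttachLeaf {n m} {H : Graph n} {H′ : Graph (suc n)} (extends : Extends H′ H)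
  (c : Fin n → Fin m) (trees : IsTreeCover H c) (w : Fin n)
  (attached : Adjacent H′ (fromℕ n) (inject₁ w))
  (only-w : ∀ i → Adjacent H′ (fromℕ n) (inject₁ i) → c i ≡ c w → i ≡ w) where

  c′ : Fin (suc n) → Fin m
  c′ = extendLast c (c w)

  old-in : ∀ {s i} → Class c s i → Class c′ s (inject₁ i)
  old-in {i = i} ci≡s = trans (extendLast-old c (c w) i) ci≡s

  old-out : ∀ {s i} → Class c′ s (inject₁ i) → Class c s i
  old-out {i = i} c′i≡s = trans (≡-sym (extendLast-old c (c w) i)) c′i≡s

  last-out : ∀ {s} → Class c′ s (fromℕ n) → Class c s w
  last-out c′last≡s = trans (≡-sym (extendLast-last c (c w))) c′last≡s

  lift-walk : ∀ {s u v} → WalkIn H (Class c s) u v → WalkIn H′ (Class c′ s) (inject₁ u) (inject₁ v)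
  lift-walk = walk-image inject₁ old-in (λ {x} {y} x~y → trans (extends x y) x~y)

  connected : ∀ s u v → Class c′ s u → Class c′ s v → WalkIn H′ (Class c′ s) u v
  connected s u v su sv with view u | view v
  ... | last  | last  = here su
  ... | old i | old j = lift-walk (proj₁ (proj₂ (trees s)) i j (old-out su) (old-out sv))
  ... | last  | old j = there su attached (lift-walk (proj₁ (proj₂ (trees s)) w j (last-out su) (old-out sv)))
  ... | old i | last  = walk-snoc (lift-walk (proj₁ (proj₂ (trees s)) i w (old-out su) (last-out sv)))
                          (Adjacent-sym H′ attached) sv

  neighbour-of-last : ∀ {y} → Adjacent H′ (fromℕ n) y → c′ y ≡ c w → y ≡ inject₁ w
  neighbour-of-last {y} last~y c′y≡cw with view y
  ... | last  = ⊥-elim (Adjacent⇒≢ H′ last~y refl)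
  ... | old i = cong inject₁ (only-w i last~y (old-out c′y≡cw))

  -- A cycle through the new vertex would give it two different neighbours
  -- in its class; a cycle avoiding it is a cycle of H.
  acyclic : ∀ s → CycleIn H′ (Class c′ s) → ⊥
  acyclic s Cy = by-cases (any? (λ j → f j ≟ᶠ fromℕ n))
    where
    open CycleIn Cy

    through-last : ∀ j → f j ≡ fromℕ n → ⊥
    through-last j fj≡last with cycle-neighbours Cy j
    ... | a , b , a≢b , fj~fa , fj~fb = a≢b (f-inj (trans (is-w a fj~fa) (≡-sym (is-w b fj~fb))))
      where
      s≡cw : s ≡ c w
      s≡cw = ≡-sym (last-out (subst (Class c′ s) fj≡last (f-in j)))
      is-w : ∀ a → Adjacent H′ (f j) (f a) → f a ≡ inject₁ w
      is-w a fj~fa = neighbour-of-last (subst (λ x → Adjacent H′ x (f a)) fj≡last fj~fa) (trans (f-in a) s≡cw)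

    avoiding-last : (∀ j → f j ≢ fromℕ n) → ⊥
    avoiding-last avoids = proj₂ (proj₂ (trees s)) (cycle-image Cy g reflects inS lower-adjacent)
      where
      g : Fin (suc len) → Fin n
      g j = lower (f j) (avoids j)
      inject₁-g : ∀ j → inject₁ (g j) ≡ f j
      inject₁-g j = inject₁-lower (f j) (avoids j)
      reflects : ∀ {a b} → g a ≡ g b → f a ≡ f b
      reflects {a} {b} ga≡gb = trans (≡-sym (inject₁-g a)) (trans (cong inject₁ ga≡gb) (inject₁-g b))
      inS : ∀ j → Class c s (g j)
      inS j = old-out (subst (Class c′ s) (≡-sym (inject₁-g j)) (f-in j))
      lower-adjacent : ∀ a b → Adjacent H′ (f a) (f b) → Adjacent H (g a) (g b)
      lower-adjacent a b fa~fb = trans (≡-sym (extends (g a) (g b)))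
        (subst₂ (Adjacent H′) (≡-sym (inject₁-g a)) (≡-sym (inject₁-g b)) fa~fb)

    by-cases : Dec (∃ λ j → f j ≡ fromℕ n) → ⊥
    by-cases (yes (j , fj≡last)) = through-last j fj≡last
    by-cases (no no-last)        = avoiding-last (λ j fj≡last → no-last (j , fj≡last))

  cover : TreeCover H′ m
  cover = c′ , λ s → nonempty s , connected s , acyclic s
    where
    nonempty : ∀ s → ∃ (Class c′ s)
    nonempty s = inject₁ (proj₁ (proj₁ (trees s))) , old-in (proj₂ (proj₁ (trees s)))

-- In the step, the new vertex is
-- attached to a k-clique C; the colours on C are at most two-to-one and |C|
-- is odd, so some vertex w of C is alone in its class among C, and it is the
-- vertex the new leaf is hung from.
builtKTree-cover : ∀ h {n} {H : Graph n} → BuiltKTree (suc (double h)) n H → TreeCover H (suc h)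
builtKTree-cover h (base G complete) = pairing-cover complete
builtKTree-cover h (step {n} {G} built C ∣C∣≡k clique G′ extends neighbourhood) =
  AttachLeaf.cover extends c trees w attached only-w
  where
  c : Fin n → Fin (suc h)
  c = proj₁ (builtKTree-cover h built)
  trees : IsTreeCover G c
  trees = proj₂ (builtKTree-cover h built)
  e : Fin ∣ C ∣ → Fin n
  e = elements C
  C-clique : Clique G ∣ C ∣
  C-clique = e , λ x y x≢y →
    clique (e x) (e y) (elements-∈ C x) (elements-∈ C y) (x≢y ∘ elements-injective C)
  alone : ∃ (Isolated (c ∘ e))
  alone = odd-isolated h ∣C∣≡k (c ∘ e) (clique-colours c trees C-clique)
  w : Fin n
  w = e (proj₁ alone)
  attached : Adjacent G′ (fromℕ n) (inject₁ w)
  attached = proj₂ (neighbourhood w) (elements-∈ C (proj₁ alone))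
  only-w : ∀ i → Adjacent G′ (fromℕ n) (inject₁ i) → c i ≡ c w → i ≡ w
  only-w i last~i ci≡cw with elements-onto C i (proj₁ (neighbourhood i) last~i)
  ... | a , refl = cong e (proj₂ alone a ci≡cw)

-- A constructed k-tree contains a clique on k + 1 vertices: the initial one.
builtKTree-clique : ∀ {k n} {H : Graph n} → BuiltKTree k n H → Clique H (suc k)
builtKTree-clique (base G complete) = (λ x → x) , complete
builtKTree-clique (step built _ _ _ G′ extends _) with builtKTree-clique built
... | e , adjacent = inject₁ ∘ e , λ x y x≢y → trans (extends (e x) (e y)) (adjacent x y x≢y)

module Isomorphic {n} {G H : Graph n} (G≅H : G ≅ H) where

  private
    to from : Fin n → Fin n
    to   = Inverse.to (proj₁ G≅H)
    from = Inverse.from (proj₁ G≅H)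

    preserves : ∀ x y → adj G x y ≡ adj H (to x) (to y)
    preserves = proj₂ G≅H

    to-from : ∀ y → to (from y) ≡ y
    to-from = Inverse.strictlyInverseˡ (proj₁ G≅H)

    from-to : ∀ x → from (to x) ≡ x
    from-to = Inverse.strictlyInverseʳ (proj₁ G≅H)

  from-adjacent : ∀ {x y} → Adjacent H x y → Adjacent G (from x) (from y)
  from-adjacent {x} {y} x~y = trans (preserves (from x) (from y))
    (subst₂ (Adjacent H) (≡-sym (to-from x)) (≡-sym (to-from y)) x~y)

  clique-pullback : ∀ {a} → Clique H a → Clique G a
  clique-pullback (e , adjacent) = from ∘ e , λ x y x≢y → from-adjacent (adjacent x y x≢y)

  cover-pullback : ∀ {m} → TreeCover H m → TreeCover G m
  cover-pullback (c , trees) = c ∘ to , λ s → nonempty s , connected s , acyclic s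
    where
    into : ∀ {s x} → Class c s x → Class (c ∘ to) s (from x)
    into {s} {x} cx≡s = subst (Class c s) (≡-sym (to-from x)) cx≡s
    nonempty : ∀ s → ∃ (Class (c ∘ to) s)
    nonempty s = from (proj₁ (proj₁ (trees s))) , into (proj₂ (proj₁ (trees s)))
    connected : ∀ s u v → Class (c ∘ to) s u → Class (c ∘ to) s v → WalkIn G (Class (c ∘ to) s) u v
    connected s u v su sv = subst₂ (WalkIn G (Class (c ∘ to) s)) (from-to u) (from-to v)
      (walk-image from into from-adjacent (proj₁ (proj₂ (trees s)) (to u) (to v) su sv))
    acyclic : ∀ s → CycleIn G (Class (c ∘ to) s) → ⊥
    acyclic s Cy = proj₂ (proj₂ (trees s)) (cycle-image Cy (to ∘ f)
      (λ tfa≡tfb → trans (≡-sym (from-to _)) (trans (cong from tfa≡tfb) (from-to _))) f-in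
      (λ a b fa~fb → trans (≡-sym (preserves (f a) (f b))) fa~fb))
      where open CycleIn Cy

odd⇒double : ∀ k → k % 2 ≡ 1 → ∃ λ h → k ≡ suc (double h)
odd⇒double zero          ()
odd⇒double (suc zero)    _     = zero , refl
odd⇒double (suc (suc k)) k-odd with odd⇒double k k-odd
... | h , refl = suc h , refl

double+1 : ∀ h → double h + 1 ≡ suc (h * 2)
double+1 zero    = refl
double+1 (suc h) = cong (2 +_) (double+1 h)

half-of-odd : ∀ h → (suc (double h) + 1) / 2 ≡ suc h
half-of-odd h = begin
  (suc (double h) + 1) / 2 ≡⟨ cong (λ x → suc x / 2) (double+1 h) ⟩
  suc h * 2 / 2            ≡⟨ m*n/n≡m (suc h) 2 ⟩
  suc h                    ∎
  where open ≡-Reasoning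

double-cancel-≤ : ∀ {a b} → double a ≤ double b → a ≤ b
double-cancel-≤ {zero}              _                 = z≤n
double-cancel-≤ {suc a} {suc b} (s≤s (s≤s 2a≤2b)) = s≤s (double-cancel-≤ 2a≤2b)

theorem6p35 : (k : ℕ) → k % 2 ≡ 1 → (n : ℕ) → (G : Graph n) →
    IsKTree k G → TreeCoverNumberIs G ((k + 1) / 2)
theorem6p35 k k-odd n G (H , built , G≅H) with odd⇒double k k-odd
... | h , refl = subst (TreeCoverNumberIs G) (≡-sym (half-of-odd h)) (upper-bound , lower-bound)
  where
  open Isomorphic {G = G} {H = H} G≅H
  upper-bound : TreeCover G (suc h)
  upper-bound = cover-pullback (builtKTree-cover h built)
  -- G contains a clique on k + 1 = 2(h + 1) vertices
  lower-bound : ∀ m → TreeCover G m → suc h ≤ m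
  lower-bound m cover = double-cancel-≤ (clique-bound (clique-pullback (builtKTree-clique built)) cover)
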